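{- For any integers $p\in\mathbb{Z}$ and $m,k,i\ge 0$, \[ \sum_{l,u\ge 1}(-1)^{u}\binom{k}{l}\binom{u-1}{l-1}\binom{m+l}{m-p+u}\binom{u-1}{i}=(-1)^{i+1}\sum_{l=0}^{k-1}\binom{i}{l}\binom{m-i}{p-i+l}. \]
   Context: For integers $a,b$, the binomial coefficient is $\binom{a}{b}=\frac{a(a-1)\cdots(a-b+1)}{b!}$ if $b\ge 0$ and $\binom{a}{b}=0$ if $b<0$ (so e.g. $\binom{ -1}{b}=(-1)^b$ for $b\ge0$). -}

module Defs where

open import Data.Nat as ℕ using (ℕ; zero; suc; _!)
open import Data.Nat.Properties using (_!≢0)
open import Data.Integer using (ℤ; +_; -[1+_]; _+_; _-_; _*_; -_)
open import Data.Integer.DivMod using (_/ℕ_)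

falling : ℤ → ℕ → ℤ
falling a zero    = + 1
falling a (suc b) = a * falling (a - + 1) b

-- generalized binomial coefficient, exactly as in the paper:
-- binom a b = a(a-1)...(a-b+1)/b!  for b ≥ 0, and 0 for b < 0.
-- (the division is exact; _/ℕ_ is integer division by the positive b!)
binom : ℤ → ℤ → ℤ
binom a (+ b)      = _/ℕ_ (falling a b) (b !) {{b !≢0}}
binom a -[1+ _ ]   = + 0

sgn : ℕ → ℤ
sgn zero    = + 1
sgn (suc n) = - sgn n

sumFrom : ℕ → ℕ → (ℕ → ℤ) → ℤ
sumFrom lo zero    f = + 0
sumFrom lo (suc n) f = f lo + sumFrom (suc lo) n f

-- Put l = a + 1 and u = v + 1. For fixed a the sum over v is
--   Σ_v (-1)^(v+1) C(v,a) C(N, n-q+v+1) C(v,i) = (-1)^(a+i+1) Σ_j (-1)^j C(a,j) C(i,j) C(n, q+j)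
-- with N = m + a + 1, n = m - i, q = p - i, so N = n + a + i + 1. It is proved by induction
-- on N ≥ 0, using Pascal's rule in the upper index on both sides. At N = 0 the left side has a
-- single term, and upper negation turns the right side into Σ_j C(a,j) C(i,j) C(x+j, a+i), which
-- equals C(x,a) C(x,i) by a telescoping recursion. Summing against C(k, a+1) and
-- exchanging the two sums, the alternating sum Σ_a (-1)^(a+j) C(k, a+1) C(a,j) is the indicator
-- of j < k, a consequence of the orthogonality relation Σ_a (-1)^(a+j) C(k,a) C(a,j) = δ_kj.
module Submission where

open import Defs
open import Data.Nat using (ℕ; suc) renaming (_≤_ to _≤ℕ_)
open import Data.Integer using (ℤ; +_; _+_; _-_; _*_; _≤_)
open import Relation.Binary.PropositionalEquality
  using (_≡_; _≢_; refl; sym; trans; cong; cong₂; subst; module ≡-Reasoning)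

import Data.Integer.Properties as ℤP
open import Algebra.Properties.CommutativeSemigroup ℤP.*-commutativeSemigroup using (x∙yz≈y∙xz)
open import Algebra.Properties.CommutativeSemigroup ℤP.+-commutativeSemigroup
  using () renaming (interchange to +-interchange)
open import Data.Empty using (⊥-elim)
open import Data.Integer using (-[1+_]; -_; _⊖_; +≤+)
open import Data.Integer.DivMod using (_/ℕ_)
open import Data.Integer.Tactic.RingSolver using (solve-∀; solve)
open import Data.List using ([]; _∷_)
open import Data.Nat as ℕ using (zero; _!; z≤n; s≤s)
import Data.Nat.DivMod as ℕDM
open import Data.Nat.Properties using (_!≢0)
import Data.Nat.Properties as ℕP
import Data.Nat.Tactic.RingSolver as ℕSolver
open import Data.Product using (_,_)
open import Relation.Nullary using (yes; no)

-- Binomial coefficients of natural numbers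

choose : ℕ → ℕ → ℕ
choose n       zero    = 1
choose zero    (suc k) = 0
choose (suc n) (suc k) = choose n k ℕ.+ choose n (suc k)

-- The number of monotone lattice paths from (0, 0) to (n, b), i.e. choose (n + b) b;
-- its recursion is symmetric in n and b.
paths : ℕ → ℕ → ℕ
paths zero    b       = 1
paths (suc n) zero    = 1
paths (suc n) (suc b) = paths n (suc b) ℕ.+ paths (suc n) b

choose-< : ∀ {n k} → n ℕ.< k → choose n k ≡ 0
choose-< {zero}  {suc k} _         = refl
choose-< {suc n} {suc k} (s≤s n<k) = cong₂ ℕ._+_ (choose-< n<k) (choose-< (ℕP.m<n⇒m<1+n n<k))

choose-diag : ∀ n → choose n n ≡ 1
choose-diag zero = refl
choose-diag (suc n) rewrite choose-diag n | choose-< (ℕP.n<1+n n) = refl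

choose-1 : ∀ n → choose n 1 ≡ n
choose-1 zero = refl
choose-1 (suc n) rewrite choose-1 n = refl

choose-absorb : ∀ n k → suc k ℕ.* choose (suc n) (suc k) ≡ suc n ℕ.* choose n k
choose-absorb n       zero    =
  trans (ℕP.+-identityʳ (choose (suc n) 1)) (trans (choose-1 (suc n)) (sym (ℕP.*-identityʳ (suc n))))
choose-absorb zero    (suc k) = ℕP.*-zeroʳ (suc (suc k))
choose-absorb (suc n) (suc k) = begin
  suc (suc k) ℕ.* (choose (suc n) (suc k) ℕ.+ choose (suc n) (suc (suc k)))
    ≡⟨ regroup (suc k) (choose (suc n) (suc k)) (choose (suc n) (suc (suc k))) ⟩
  choose (suc n) (suc k) ℕ.+ suc k ℕ.* choose (suc n) (suc k) ℕ.+ suc (suc k) ℕ.* choose (suc n) (suc (suc k))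
    ≡⟨ cong₂ (λ x y → choose (suc n) (suc k) ℕ.+ x ℕ.+ y) (choose-absorb n k) (choose-absorb n (suc k)) ⟩
  choose n k ℕ.+ choose n (suc k) ℕ.+ suc n ℕ.* choose n k ℕ.+ suc n ℕ.* choose n (suc k)
    ≡⟨ collect (suc n) (choose n k) (choose n (suc k)) ⟩
  suc (suc n) ℕ.* (choose n k ℕ.+ choose n (suc k)) ∎
  where
  open ≡-Reasoning
  regroup : ∀ k x y → suc k ℕ.* (x ℕ.+ y) ≡ x ℕ.+ k ℕ.* x ℕ.+ suc k ℕ.* y
  regroup = ℕSolver.solve-∀
  collect : ∀ n x y → x ℕ.+ y ℕ.+ n ℕ.* x ℕ.+ n ℕ.* y ≡ suc n ℕ.* (x ℕ.+ y)
  collect = ℕSolver.solve-∀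

paths-zeroʳ : ∀ n → paths n 0 ≡ 1
paths-zeroʳ zero    = refl
paths-zeroʳ (suc n) = refl

paths-comm : ∀ n b → paths n b ≡ paths b n
paths-comm zero    zero    = refl
paths-comm zero    (suc b) = refl
paths-comm (suc n) zero    = refl
paths-comm (suc n) (suc b) rewrite paths-comm n (suc b) | paths-comm (suc n) b
  | paths-comm b (suc n) | paths-comm (suc b) n = ℕP.+-comm (paths n (suc b)) (paths (suc n) b)

paths≡choose : ∀ n b → paths n b ≡ choose (n ℕ.+ b) b
paths≡choose zero    b       = sym (choose-diag b)
paths≡choose (suc n) zero    = refl
paths≡choose (suc n) (suc b) rewrite paths≡choose n (suc b) | paths≡choose (suc n) b | ℕP.+-suc n b
  = ℕP.+-comm (choose (suc (n ℕ.+ b)) (suc b)) (choose (suc (n ℕ.+ b)) b)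

choose-sym : ∀ a b → choose (a ℕ.+ b) b ≡ choose (a ℕ.+ b) a
choose-sym a b = begin
  choose (a ℕ.+ b) b ≡⟨ sym (paths≡choose a b) ⟩
  paths a b          ≡⟨ paths-comm a b ⟩
  paths b a          ≡⟨ paths≡choose b a ⟩
  choose (b ℕ.+ a) a ≡⟨ cong (λ t → choose t a) (ℕP.+-comm b a) ⟩
  choose (a ℕ.+ b) a ∎
  where open ≡-Reasoning

paths-absorb : ∀ n b → suc n ℕ.* paths (suc n) b ≡ suc b ℕ.* paths n (suc b)
paths-absorb n b = begin
  suc n ℕ.* paths (suc n) b                ≡⟨ cong (suc n ℕ.*_) (paths≡choose (suc n) b) ⟩
  suc n ℕ.* choose (suc n ℕ.+ b) b         ≡⟨ cong (suc n ℕ.*_) (choose-sym (suc n) b) ⟩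
  suc n ℕ.* choose (suc (n ℕ.+ b)) (suc n)  ≡⟨ choose-absorb (n ℕ.+ b) n ⟩
  suc (n ℕ.+ b) ℕ.* choose (n ℕ.+ b) n      ≡⟨ cong (suc (n ℕ.+ b) ℕ.*_) (sym (choose-sym n b)) ⟩
  suc (n ℕ.+ b) ℕ.* choose (n ℕ.+ b) b      ≡⟨ sym (choose-absorb (n ℕ.+ b) b) ⟩
  suc b ℕ.* choose (suc (n ℕ.+ b)) (suc b)  ≡⟨ cong (λ t → suc b ℕ.* choose t (suc b)) (sym (ℕP.+-suc n b)) ⟩
  suc b ℕ.* choose (n ℕ.+ suc b) (suc b)    ≡⟨ cong (suc b ℕ.*_) (sym (paths≡choose n (suc b))) ⟩
  suc b ℕ.* paths n (suc b)                ∎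
  where open ≡-Reasoning

-- Binomial coefficients with an integer upper index

-- On a negative upper index this is upper negation: binom (-1-n) k = (-1)^k binom (n+k) k.
bin : ℤ → ℤ → ℤ
bin (+ n)    (+ k)    = + choose n k
bin (+ n)    -[1+ _ ] = + 0
bin -[1+ n ] (+ k)    = sgn k * + paths n k
bin -[1+ n ] -[1+ _ ] = + 0

bin-zeroʳ : ∀ a → bin a (+ 0) ≡ + 1
bin-zeroʳ (+ n)    = refl
bin-zeroʳ -[1+ n ] rewrite paths-zeroʳ n = refl

bin-pascal : ∀ a b → bin (+ 1 + a) b ≡ bin a (b - + 1) + bin a b
bin-pascal (+ n)          (+ zero)   = refl
bin-pascal (+ n)          (+ suc k)  = refl
bin-pascal (+ n)          -[1+ k ]   = refl
bin-pascal -[1+ zero ]    (+ zero)   = refl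
bin-pascal -[1+ zero ]    (+ suc k)  = cancel (sgn k)
  where
  cancel : ∀ s → + 0 ≡ s * + 1 + (- s) * + 1
  cancel = solve-∀
bin-pascal -[1+ zero ]    -[1+ k ]   = refl
bin-pascal -[1+ suc n ]   (+ zero)   rewrite paths-zeroʳ n = refl
bin-pascal -[1+ suc n ]   (+ suc k)  =
  trans (split (sgn k) (+ paths n (suc k)) (+ paths (suc n) k))
        (cong (λ t → sgn k * + paths (suc n) k + - sgn k * t) (sym (ℤP.pos-+ (paths n (suc k)) (paths (suc n) k))))
  where
  split : ∀ s x y → (- s) * x ≡ s * y + (- s) * (x + y)
  split = solve-∀
bin-pascal -[1+ suc n ]   -[1+ k ]   = refl

bin-absorb : ∀ a b → a * bin (a - + 1) (+ b) ≡ + suc b * bin a (+ suc b)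
bin-absorb (+ zero)    b = sym (ℤP.*-zeroʳ (+ suc b))
bin-absorb (+ suc n)   b = begin
  + suc n * + choose n b            ≡⟨ sym (ℤP.pos-* (suc n) (choose n b)) ⟩
  + (suc n ℕ.* choose n b)          ≡⟨ cong +_ (sym (choose-absorb n b)) ⟩
  + (suc b ℕ.* choose (suc n) (suc b)) ≡⟨ ℤP.pos-* (suc b) (choose (suc n) (suc b)) ⟩
  + suc b * + choose (suc n) (suc b) ∎
  where open ≡-Reasoning
bin-absorb -[1+ n ]    b rewrite ℕP.+-identityʳ n =
  move-signs (+ suc n) (+ paths (suc n) b) (+ suc b) (+ paths n (suc b)) (sgn b)
    (trans (sym (ℤP.pos-* (suc n) (paths (suc n) b)))
    (trans (cong +_ (paths-absorb n b)) (ℤP.pos-* (suc b) (paths n (suc b)))))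
  where
  move-signs : ∀ x y z w s → x * y ≡ z * w → (- x) * (s * y) ≡ z * ((- s) * w)
  move-signs x y z w s eq = begin
    (- x) * (s * y) ≡⟨ solve (x ∷ y ∷ s ∷ []) ⟩
    - (s * (x * y)) ≡⟨ cong (λ t → - (s * t)) eq ⟩
    - (s * (z * w)) ≡⟨ solve (z ∷ w ∷ s ∷ []) ⟩
    z * ((- s) * w) ∎
    where open ≡-Reasoning

-[1+]/ℕ-exact : ∀ t d .{{_ : ℕ.NonZero d}} → suc t ℕ.% d ≡ 0 → -[1+ t ] /ℕ d ≡ - + (suc t ℕ./ d)
-[1+]/ℕ-exact t d eq with suc t ℕ.% d | eq
... | zero | _ = refl

/ℕ-exact : ∀ d .{{_ : ℕ.NonZero d}} x → (+ d * x) /ℕ d ≡ x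
/ℕ-exact d@(suc _) (+ y) rewrite sym (ℤP.pos-* d y) | ℕP.*-comm d y = cong +_ (ℕDM.m*n/n≡m y d)
/ℕ-exact d@(suc _) -[1+ y ] =
  trans (-[1+]/ℕ-exact _ d (trans (cong (ℕ._% d) product) (ℕDM.m*n%n≡0 (suc y) d)))
        (cong (λ t → - + t) (trans (cong (ℕ._/ d) product) (ℕDM.m*n/n≡m (suc y) d)))
  where
  product : d ℕ.* suc y ≡ suc y ℕ.* d
  product = ℕP.*-comm d (suc y)

falling≡!*bin : ∀ b a → falling a b ≡ + (b !) * bin a (+ b)
falling≡!*bin zero    a = sym (trans (ℤP.*-identityˡ (bin a (+ 0))) (bin-zeroʳ a))
falling≡!*bin (suc b) a = begin
  a * falling (a - + 1) b                  ≡⟨ cong (a *_) (falling≡!*bin b (a - + 1)) ⟩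
  a * (+ (b !) * bin (a - + 1) (+ b))      ≡⟨ x∙yz≈y∙xz a (+ (b !)) _ ⟩
  + (b !) * (a * bin (a - + 1) (+ b))      ≡⟨ cong (+ (b !) *_) (bin-absorb a b) ⟩
  + (b !) * (+ suc b * bin a (+ suc b))    ≡⟨ x∙yz≈y∙xz (+ (b !)) (+ suc b) _ ⟩
  + suc b * (+ (b !) * bin a (+ suc b))    ≡⟨ sym (ℤP.*-assoc (+ suc b) (+ (b !)) _) ⟩
  + suc b * + (b !) * bin a (+ suc b)      ≡⟨ cong (_* bin a (+ suc b)) (sym (ℤP.pos-* (suc b) (b !))) ⟩
  + (suc b ℕ.* b !) * bin a (+ suc b)      ∎
  where open ≡-Reasoning

binom≡bin : ∀ a b → binom a b ≡ bin a b
binom≡bin a        (+ b)    =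
  trans (cong (λ t → _/ℕ_ t (b !) {{b !≢0}}) (falling≡!*bin b a)) (/ℕ-exact (b !) {{b !≢0}} (bin a (+ b)))
binom≡bin (+ n)    -[1+ b ] = refl
binom≡bin -[1+ n ] -[1+ b ] = refl

-- Finite sums

sum-cong-< : ∀ lo n {f g : ℕ → ℤ} → (∀ j → lo ℕ.≤ j → j ℕ.< lo ℕ.+ n → f j ≡ g j) →
             sumFrom lo n f ≡ sumFrom lo n g
sum-cong-< lo zero    eq = refl
sum-cong-< lo (suc n) eq = cong₂ _+_
  (eq lo ℕP.≤-refl (subst (lo ℕ.<_) (sym (ℕP.+-suc lo n)) (ℕP.m≤m+n (suc lo) n)))
  (sum-cong-< (suc lo) n (λ j lo<j j<end →
    eq j (ℕP.<⇒≤ lo<j) (subst (j ℕ.<_) (sym (ℕP.+-suc lo n)) j<end)))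

sum-cong : ∀ lo n {f g : ℕ → ℤ} → (∀ j → f j ≡ g j) → sumFrom lo n f ≡ sumFrom lo n g
sum-cong lo n eq = sum-cong-< lo n (λ j _ _ → eq j)

sum-zero : ∀ lo n {f : ℕ → ℤ} → (∀ j → lo ℕ.≤ j → j ℕ.< lo ℕ.+ n → f j ≡ + 0) → sumFrom lo n f ≡ + 0
sum-zero lo n eq = trans (sum-cong-< lo n eq) (zeros lo n)
  where
  zeros : ∀ lo n → sumFrom lo n (λ _ → + 0) ≡ + 0
  zeros lo zero    = refl
  zeros lo (suc n) = trans (ℤP.+-identityˡ _) (zeros (suc lo) n)

sum-single : ∀ lo n (f : ℕ → ℤ) t → lo ℕ.≤ t → t ℕ.< lo ℕ.+ n → (∀ j → j ≢ t → f j ≡ + 0) →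
             sumFrom lo n f ≡ f t
sum-single lo zero    f t lo≤t t<lo+0 _ =
  ⊥-elim (ℕP.<-irrefl refl (ℕP.<-≤-trans t<lo+0 (subst (ℕ._≤ t) (sym (ℕP.+-identityʳ lo)) lo≤t)))
sum-single lo (suc n) f t lo≤t t<end off with lo ℕ.≟ t
... | yes refl = trans (cong (λ s → f lo + s) (sum-zero (suc lo) n (λ j lo<j _ → off j (ℕP.>⇒≢ lo<j))))
                       (ℤP.+-identityʳ (f lo))
... | no lo≢t  = trans (cong (_+ sumFrom (suc lo) n f) (off lo lo≢t)) (trans (ℤP.+-identityˡ _)
                       (sum-single (suc lo) n f t (ℕP.≤∧≢⇒< lo≤t lo≢t) (subst (t ℕ.<_) (ℕP.+-suc lo n) t<end) off))

sum-+ : ∀ lo n (f g : ℕ → ℤ) → sumFrom lo n (λ j → f j + g j) ≡ sumFrom lo n f + sumFrom lo n g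
sum-+ lo zero    f g = refl
sum-+ lo (suc n) f g = trans (cong (λ t → f lo + g lo + t) (sum-+ (suc lo) n f g))
                             (+-interchange (f lo) (g lo) _ _)

sum-neg : ∀ lo n (f : ℕ → ℤ) → sumFrom lo n (λ j → - f j) ≡ - sumFrom lo n f
sum-neg lo zero    f = refl
sum-neg lo (suc n) f = trans (cong (λ t → - f lo + t) (sum-neg (suc lo) n f)) (sym (ℤP.neg-distrib-+ (f lo) _))

sum-- : ∀ lo n (f g : ℕ → ℤ) → sumFrom lo n (λ j → f j - g j) ≡ sumFrom lo n f - sumFrom lo n g
sum-- lo n f g = trans (sum-+ lo n f (λ j → - g j)) (cong (λ t → sumFrom lo n f + t) (sum-neg lo n g))

sum-*ˡ : ∀ lo n (c : ℤ) (f : ℕ → ℤ) → sumFrom lo n (λ j → c * f j) ≡ c * sumFrom lo n f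
sum-*ˡ lo zero    c f = sym (ℤP.*-zeroʳ c)
sum-*ˡ lo (suc n) c f = trans (cong (λ t → c * f lo + t) (sum-*ˡ (suc lo) n c f)) (sym (ℤP.*-distribˡ-+ c (f lo) _))

sum-*ʳ : ∀ lo n (f : ℕ → ℤ) (c : ℤ) → sumFrom lo n (λ j → f j * c) ≡ sumFrom lo n f * c
sum-*ʳ lo n f c = trans (sum-cong lo n (λ j → ℤP.*-comm (f j) c)) (trans (sum-*ˡ lo n c f) (ℤP.*-comm c _))

sum-shift : ∀ lo n (f : ℕ → ℤ) → sumFrom (suc lo) n f ≡ sumFrom lo n (λ j → f (suc j))
sum-shift lo zero    f = refl
sum-shift lo (suc n) f = cong (λ t → f (suc lo) + t) (sum-shift (suc lo) n f)

sum-split : ∀ lo m n (f : ℕ → ℤ) → sumFrom lo (m ℕ.+ n) f ≡ sumFrom lo m f + sumFrom (lo ℕ.+ m) n f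
sum-split lo zero    n f = trans (cong (λ t → sumFrom t n f) (sym (ℕP.+-identityʳ lo))) (sym (ℤP.+-identityˡ _))
sum-split lo (suc m) n f = trans
  (cong (λ t → f lo + t) (trans (sum-split (suc lo) m n f) (cong (λ t → sumFrom (suc lo) m f + sumFrom t n f) (sym (ℕP.+-suc lo m)))))
  (sym (ℤP.+-assoc (f lo) _ _))

sum-comm : ∀ a m b n (F : ℕ → ℕ → ℤ) →
  sumFrom a m (λ x → sumFrom b n (F x)) ≡ sumFrom b n (λ y → sumFrom a m (λ x → F x y))
sum-comm a zero    b n F = sym (sum-zero b n (λ _ _ _ → refl))
sum-comm a (suc m) b n F = trans (cong (λ t → sumFrom b n (F a) + t) (sum-comm (suc a) m b n F))
                                 (sym (sum-+ b n (F a) (λ y → sumFrom (suc a) m (λ x → F x y))))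

sum-telescope : ∀ lo n (h : ℕ → ℤ) → sumFrom lo n (λ j → h j - h (suc j)) ≡ h lo - h (lo ℕ.+ n)
sum-telescope lo zero    h = sym (trans (cong (λ t → h lo - h t) (ℕP.+-identityʳ lo)) (ℤP.+-inverseʳ (h lo)))
sum-telescope lo (suc n) h = begin
  h lo - h (suc lo) + sumFrom (suc lo) n (λ j → h j - h (suc j))
    ≡⟨ cong (λ t → h lo - h (suc lo) + t) (sum-telescope (suc lo) n h) ⟩
  h lo - h (suc lo) + (h (suc lo) - h (suc lo ℕ.+ n))
    ≡⟨ cancel (h lo) (h (suc lo)) (h (suc lo ℕ.+ n)) ⟩
  h lo - h (suc lo ℕ.+ n)
    ≡⟨ cong (λ t → h lo - h t) (sym (ℕP.+-suc lo n)) ⟩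
  h lo - h (lo ℕ.+ suc n) ∎
  where
  open ≡-Reasoning
  cancel : ∀ x y z → x - y + (y - z) ≡ x - z
  cancel = solve-∀

-- A product formula

C : ℕ → ℕ → ℤ
C n k = + choose n k

C-< : ∀ {n k} → n ℕ.< k → C n k ≡ + 0
C-< n<k = cong +_ (choose-< n<k)

S : ℕ → ℕ → ℕ → ℕ → ℕ → ℤ
S a i e x J = sumFrom 0 J (λ j → C a j * (C i j * C (x ℕ.+ j) e))

S-step : ∀ a i e x J → suc a ℕ.< J →
  S (suc a) (suc i) (suc e) x J ≡ S a i e x J + S a (suc i) (suc e) x J + S (suc a) i (suc e) x J
S-step a i e x (suc J) (s≤s a<J) = begin
  Σ term₁
    ≡⟨ rearrange (Σ term₁) (Σ term₂) (Σ term₃) (Σ term₄) ⟩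
  (Σ term₁ - Σ term₂ - Σ term₃ - Σ term₄) + (Σ term₄ + Σ term₂ + Σ term₃)
    ≡⟨ cong (_+ (Σ term₄ + Σ term₂ + Σ term₃)) telescoped ⟩
  + 0 + (Σ term₄ + Σ term₂ + Σ term₃)
    ≡⟨ ℤP.+-identityˡ _ ⟩
  Σ term₄ + Σ term₂ + Σ term₃ ∎
  where
  open ≡-Reasoning
  Σ : (ℕ → ℤ) → ℤ
  Σ = sumFrom 0 (suc J)
  term₁ term₂ term₃ term₄ : ℕ → ℤ
  term₁ j = C (suc a) j * (C (suc i) j * C (x ℕ.+ j) (suc e))
  term₂ j = C a j       * (C (suc i) j * C (x ℕ.+ j) (suc e))
  term₃ j = C (suc a) j * (C i j       * C (x ℕ.+ j) (suc e))
  term₄ j = C a j       * (C i j       * C (x ℕ.+ j) e)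
  -- Pascal's rule in all three factors leaves the difference of consecutive values of h.
  h : ℕ → ℤ
  h zero    = + 0
  h (suc j) = C a j * (C i j * C (x ℕ.+ suc j) (suc e))
  termwise : ∀ j → term₁ j - term₂ j - term₃ j - term₄ j ≡ h j - h (suc j)
  termwise zero rewrite ℕP.+-identityʳ x | ℕP.+-suc x 0 | ℕP.+-identityʳ x = base (C x e) (C x (suc e))
    where
    base : ∀ v w → + 1 * (+ 1 * w) - + 1 * (+ 1 * w) - + 1 * (+ 1 * w) - + 1 * (+ 1 * v) ≡ + 0 - + 1 * (+ 1 * (v + w))
    base = solve-∀
  termwise (suc j) rewrite ℕP.+-suc x (suc j) =
    step (C a j) (C a (suc j)) (C i j) (C i (suc j)) (C (x ℕ.+ suc j) e) (C (x ℕ.+ suc j) (suc e))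
    where
    step : ∀ α₀ α₁ β₀ β₁ v w →
      (α₀ + α₁) * ((β₀ + β₁) * w) - α₁ * ((β₀ + β₁) * w) - (α₀ + α₁) * (β₁ * w) - α₁ * (β₁ * v)
        ≡ α₀ * (β₀ * w) - α₁ * (β₁ * (v + w))
    step = solve-∀
  telescoped : Σ term₁ - Σ term₂ - Σ term₃ - Σ term₄ ≡ + 0
  telescoped = begin
    Σ term₁ - Σ term₂ - Σ term₃ - Σ term₄
      ≡⟨ sym (trans (sum-- 0 (suc J) (λ j → term₁ j - term₂ j - term₃ j) term₄)
               (cong (_- Σ term₄) (trans (sum-- 0 (suc J) (λ j → term₁ j - term₂ j) term₃)
               (cong (_- Σ term₃) (sum-- 0 (suc J) term₁ term₂))))) ⟩
    Σ (λ j → term₁ j - term₂ j - term₃ j - term₄ j)  ≡⟨ sum-cong 0 (suc J) termwise ⟩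
    Σ (λ j → h j - h (suc j))                         ≡⟨ sum-telescope 0 (suc J) h ⟩
    + 0 - h (suc J)                                   ≡⟨ cong (λ t → + 0 - + t * (C i J * C (x ℕ.+ suc J) (suc e))) (choose-< a<J) ⟩
    + 0                                               ∎
  rearrange : ∀ p q r s → p ≡ (p - q - r - s) + (s + q + r)
  rearrange = solve-∀

S-zeroˡ : ∀ i e x J → 0 ℕ.< J → S 0 i e x J ≡ C x e
S-zeroˡ i e x J 0<J = begin
  S 0 i e x J                    ≡⟨ sum-single 0 J _ 0 z≤n 0<J (λ { zero j≢0 → ⊥-elim (j≢0 refl) ; (suc j) _ → refl }) ⟩
  + 1 * (+ 1 * C (x ℕ.+ 0) e)    ≡⟨ trans (ℤP.*-identityˡ _) (ℤP.*-identityˡ _) ⟩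
  C (x ℕ.+ 0) e                  ≡⟨ cong (λ t → C t e) (ℕP.+-identityʳ x) ⟩
  C x e                          ∎
  where open ≡-Reasoning

S-zeroʳ : ∀ a e x J → 0 ℕ.< J → S a 0 e x J ≡ C x e
S-zeroʳ a e x J 0<J = begin
  S a 0 e x J                    ≡⟨ sum-single 0 J _ 0 z≤n 0<J (λ { zero j≢0 → ⊥-elim (j≢0 refl) ; (suc j) _ → ℤP.*-zeroʳ (C a (suc j)) }) ⟩
  + 1 * (+ 1 * C (x ℕ.+ 0) e)    ≡⟨ trans (ℤP.*-identityˡ _) (ℤP.*-identityˡ _) ⟩
  C (x ℕ.+ 0) e                  ≡⟨ cong (λ t → C t e) (ℕP.+-identityʳ x) ⟩
  C x e                          ∎
  where open ≡-Reasoning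

S-diagonal : ∀ x a i J → a ℕ.< J → S a i (a ℕ.+ i) x J ≡ C x a * C x i
S-diagonal x       zero    i       J a<J = trans (S-zeroˡ i i x J a<J) (sym (ℤP.*-identityˡ _))
S-diagonal x       (suc a) zero    J a<J = begin
  S (suc a) 0 (suc a ℕ.+ 0) x J ≡⟨ S-zeroʳ (suc a) (suc a ℕ.+ 0) x J (ℕP.<-trans (s≤s z≤n) a<J) ⟩
  C x (suc a ℕ.+ 0)             ≡⟨ cong (C x) (ℕP.+-identityʳ (suc a)) ⟩
  C x (suc a)                   ≡⟨ sym (ℤP.*-identityʳ _) ⟩
  C x (suc a) * C x 0           ∎
  where open ≡-Reasoning
S-diagonal zero    (suc a) (suc i) J a<J = sum-zero 0 J vanishes
  where
  vanishes : ∀ j → 0 ℕ.≤ j → j ℕ.< 0 ℕ.+ J → C (suc a) j * (C (suc i) j * C j (suc a ℕ.+ suc i)) ≡ + 0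
  vanishes j _ _ with j ℕ.≤? suc a
  ... | yes j≤a = begin
    C (suc a) j * (C (suc i) j * C j (suc a ℕ.+ suc i))
      ≡⟨ cong (λ t → C (suc a) j * (C (suc i) j * t)) (C-< (ℕP.≤-<-trans j≤a (ℕP.m<m+n (suc a) (s≤s z≤n)))) ⟩
    C (suc a) j * (C (suc i) j * + 0)
      ≡⟨ cong (C (suc a) j *_) (ℤP.*-zeroʳ (C (suc i) j)) ⟩
    C (suc a) j * + 0
      ≡⟨ ℤP.*-zeroʳ (C (suc a) j) ⟩
    + 0 ∎
    where open ≡-Reasoning
  ... | no j≰a = cong (_* (C (suc i) j * C j (suc a ℕ.+ suc i))) (C-< (ℕP.≰⇒> j≰a))
S-diagonal (suc x) (suc a) (suc i) J a<J = begin
  S (suc a) (suc i) (suc (a ℕ.+ suc i)) (suc x) J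
    ≡⟨ trans (sum-cong 0 J (λ j → *-distribˡ-+² (C (suc a) j) (C (suc i) j) (C (x ℕ.+ j) e′) (C (x ℕ.+ j) (suc e′))))
             (sum-+ 0 J _ _) ⟩
  S (suc a) (suc i) (a ℕ.+ suc i) x J + S (suc a) (suc i) (suc (a ℕ.+ suc i)) x J
    ≡⟨ cong (λ e → S (suc a) (suc i) e x J + S (suc a) (suc i) (suc e′) x J) (ℕP.+-suc a i) ⟩
  S (suc a) (suc i) (suc (a ℕ.+ i)) x J + S (suc a) (suc i) (suc (a ℕ.+ suc i)) x J
    ≡⟨ cong (_+ S (suc a) (suc i) (suc e′) x J) (S-step a i (a ℕ.+ i) x J a<J) ⟩
  S a i (a ℕ.+ i) x J + S a (suc i) (suc (a ℕ.+ i)) x J + S (suc a) i (suc a ℕ.+ i) x J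
    + S (suc a) (suc i) (suc a ℕ.+ suc i) x J
    ≡⟨ cong (λ e → S a i (a ℕ.+ i) x J + S a (suc i) e x J + S (suc a) i (suc a ℕ.+ i) x J
                   + S (suc a) (suc i) (suc e′) x J) (sym (ℕP.+-suc a i)) ⟩
  S a i (a ℕ.+ i) x J + S a (suc i) (a ℕ.+ suc i) x J + S (suc a) i (suc a ℕ.+ i) x J
    + S (suc a) (suc i) (suc a ℕ.+ suc i) x J
    ≡⟨ cong₂ _+_ (cong₂ _+_ (cong₂ _+_ (S-diagonal x a i J a<J′) (S-diagonal x a (suc i) J a<J′))
                            (S-diagonal x (suc a) i J a<J))
                 (S-diagonal x (suc a) (suc i) J a<J) ⟩
  C x a * C x i + C x a * C x (suc i) + C x (suc a) * C x i + C x (suc a) * C x (suc i)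
    ≡⟨ expand (C x a) (C x (suc a)) (C x i) (C x (suc i)) ⟩
  (C x a + C x (suc a)) * (C x i + C x (suc i)) ∎
  where
  open ≡-Reasoning
  e′ : ℕ
  e′ = a ℕ.+ suc i
  a<J′ : a ℕ.< J
  a<J′ = ℕP.<-trans (ℕP.n<1+n a) a<J
  *-distribˡ-+² : ∀ α β v w → α * (β * (v + w)) ≡ α * (β * v) + α * (β * w)
  *-distribˡ-+² = solve-∀
  expand : ∀ α₀ α₁ β₀ β₁ → α₀ * β₀ + α₀ * β₁ + α₁ * β₀ + α₁ * β₁ ≡ (α₀ + α₁) * (β₀ + β₁)
  expand = solve-∀

-- Signs and upper negation

sgn-+ : ∀ m n → sgn (m ℕ.+ n) ≡ sgn m * sgn n
sgn-+ zero    n = sym (ℤP.*-identityˡ (sgn n))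
sgn-+ (suc m) n = trans (cong -_ (sgn-+ m n)) (ℤP.neg-distribˡ-* (sgn m) (sgn n))

sgn-square : ∀ n → sgn n * sgn n ≡ + 1
sgn-square zero    = refl
sgn-square (suc n) = trans (neg*neg (sgn n)) (sgn-square n)
  where
  neg*neg : ∀ s → (- s) * (- s) ≡ s * s
  neg*neg = solve-∀

bin-negʳ : ∀ a k → bin a -[1+ k ] ≡ + 0
bin-negʳ (+ n)    k = refl
bin-negʳ -[1+ n ] k = refl

bin-0-⊖ : ∀ v x → v ≢ x → bin (+ 0) (v ⊖ x) ≡ + 0
bin-0-⊖ zero    zero    v≢x = ⊥-elim (v≢x refl)
bin-0-⊖ zero    (suc x) _   = refl
bin-0-⊖ (suc v) zero    _   = refl
bin-0-⊖ (suc v) (suc x) v≢x = trans (cong (bin (+ 0)) (ℤP.[1+m]⊖[1+n]≡m⊖n v x)) (bin-0-⊖ v x (λ v≡x → v≢x (cong suc v≡x)))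

bin-upper-negation : ∀ e y → sgn e * bin -[1+ e ] (y ⊖ e) ≡ sgn y * C y e
bin-upper-negation e y with e ℕ.≤? y
... | yes e≤y with ℕP.m≤n⇒∃[o]m+o≡n e≤y
...   | t , refl = begin
  sgn e * bin -[1+ e ] ((e ℕ.+ t) ⊖ e) ≡⟨ cong (λ b → sgn e * bin -[1+ e ] b) (trans (ℤP.⊖-≥ (ℕP.m≤m+n e t)) (cong +_ (ℕP.m+n∸m≡n e t))) ⟩
  sgn e * (sgn t * + paths e t)        ≡⟨ sym (ℤP.*-assoc (sgn e) (sgn t) _) ⟩
  sgn e * sgn t * + paths e t          ≡⟨ cong₂ _*_ (sym (sgn-+ e t)) (cong +_ (trans (paths≡choose e t) (choose-sym e t))) ⟩
  sgn (e ℕ.+ t) * C (e ℕ.+ t) e        ∎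
  where open ≡-Reasoning
bin-upper-negation e y | no e≰y with ℕP.m≤n⇒∃[o]m+o≡n (ℕP.≰⇒> e≰y)
...   | t , refl =
  trans (cong (λ b → sgn (suc y ℕ.+ t) * bin -[1+ suc y ℕ.+ t ] b) y⊖e≡-[1+t])
        (trans (ℤP.*-zeroʳ (sgn (suc y ℕ.+ t))) (sym (trans (cong (sgn y *_) (C-< y<e)) (ℤP.*-zeroʳ (sgn y)))))
  where
  y<e : y ℕ.< suc (y ℕ.+ t)
  y<e = s≤s (ℕP.m≤m+n y t)
  y⊖e≡-[1+t] : y ⊖ suc (y ℕ.+ t) ≡ -[1+ t ]
  y⊖e≡-[1+t] = trans (ℤP.⊖-< y<e)
    (cong (λ k → - + k) (trans (ℕP.+-∸-assoc 1 (ℕP.m≤m+n y t)) (cong suc (ℕP.m+n∸m≡n y t))))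

-- The inner sums

-[1+t]+j : ∀ {t j} → j ℕ.≤ t → -[1+ t ] + + j ≡ -[1+ (t ℕ.∸ j) ]
-[1+t]+j j≤t = trans (ℤP.⊖-< (s≤s j≤t)) (cong (λ k → - + k) (ℕP.+-∸-assoc 1 j≤t))

Σv : ℕ → ℕ → ℕ → ℤ → ℕ → ℤ
Σv a i N s U = sumFrom 0 U (λ v → sgn (suc v) * (C v a * (bin (+ N) (s + + suc v) * C v i)))

Σj : ℕ → ℕ → ℤ → ℤ → ℕ → ℤ
Σj a i n q J = sumFrom 0 J (λ j → sgn j * (C a j * (C i j * bin n (q + + j))))

Σv-bottom-nonneg : ∀ a i t U → Σv a i 0 (+ t) U ≡ + 0
Σv-bottom-nonneg a i t U = sum-zero 0 U (λ v _ _ →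
  trans (cong (λ b → sgn (suc v) * (C v a * (b * C v i))) (C-< (ℕP.<-≤-trans (s≤s z≤n) (ℕP.m≤n+m (suc v) t))))
        (vanish (sgn (suc v)) (C v a) (C v i)))
  where
  vanish : ∀ s x y → s * (x * (+ 0 * y)) ≡ + 0
  vanish = solve-∀

Σv-bottom-single : ∀ a i x U → x ℕ.< U → Σv a i 0 -[1+ x ] U ≡ sgn (suc x) * (C x a * C x i)
Σv-bottom-single a i x U x<U = begin
  Σv a i 0 -[1+ x ] U                                        ≡⟨ sum-single 0 U _ x z≤n x<U off-diagonal ⟩
  sgn (suc x) * (C x a * (bin (+ 0) (suc x ⊖ suc x) * C x i)) ≡⟨ cong (λ b → sgn (suc x) * (C x a * (bin (+ 0) b * C x i))) x⊖x≡0 ⟩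
  sgn (suc x) * (C x a * (+ 1 * C x i))                       ≡⟨ cong (λ t → sgn (suc x) * (C x a * t)) (ℤP.*-identityˡ (C x i)) ⟩
  sgn (suc x) * (C x a * C x i)                               ∎
  where
  open ≡-Reasoning
  x⊖x≡0 : suc x ⊖ suc x ≡ + 0
  x⊖x≡0 = trans (ℤP.[1+m]⊖[1+n]≡m⊖n x x) (ℤP.n⊖n≡0 x)
  vanish : ∀ s x y → s * (x * (+ 0 * y)) ≡ + 0
  vanish = solve-∀
  off-diagonal : ∀ v → v ≢ x → sgn (suc v) * (C v a * (bin (+ 0) (suc v ⊖ suc x) * C v i)) ≡ + 0
  off-diagonal v v≢x = trans
    (cong (λ b → sgn (suc v) * (C v a * (b * C v i))) (trans (cong (bin (+ 0)) (ℤP.[1+m]⊖[1+n]≡m⊖n v x)) (bin-0-⊖ v x v≢x)))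
    (vanish (sgn (suc v)) (C v a) (C v i))

Σj-below : ∀ a i n t J → a ℕ.≤ t → Σj a i n -[1+ t ] J ≡ + 0
Σj-below a i n t J a≤t = sum-zero 0 J vanishes
  where
  vanish : ∀ s x y → s * (x * (y * + 0)) ≡ + 0
  vanish = solve-∀
  vanishes : ∀ j → 0 ℕ.≤ j → j ℕ.< 0 ℕ.+ J → sgn j * (C a j * (C i j * bin n (-[1+ t ] + + j))) ≡ + 0
  vanishes j _ _ with j ℕ.≤? a
  ... | yes j≤a = trans (cong (λ b → sgn j * (C a j * (C i j * b)))
                          (trans (cong (bin n) (-[1+t]+j (ℕP.≤-trans j≤a a≤t))) (bin-negʳ n (t ℕ.∸ j))))
                        (vanish (sgn j) (C a j) (C i j))
  ... | no j≰a  = trans (cong (λ x → sgn j * (x * (C i j * bin n (-[1+ t ] + + j)))) (C-< (ℕP.≰⇒> j≰a)))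
                        (ℤP.*-zeroʳ (sgn j))

upper-negation-signed : ∀ e x j → sgn (suc e) * (sgn j * bin -[1+ e ] ((x ℕ.+ j) ⊖ e)) ≡ sgn (suc x) * C (x ℕ.+ j) e
upper-negation-signed e x j =
  rearrange (sgn e) (sgn j) (sgn x) (bin -[1+ e ] ((x ℕ.+ j) ⊖ e)) (C (x ℕ.+ j) e)
    (trans (bin-upper-negation e (x ℕ.+ j)) (cong (_* C (x ℕ.+ j) e) (sgn-+ x j))) (sgn-square j)
  where
  rearrange : ∀ sₑ sⱼ sₓ b c → sₑ * b ≡ sₓ * sⱼ * c → sⱼ * sⱼ ≡ + 1 → (- sₑ) * (sⱼ * b) ≡ (- sₓ) * c
  rearrange sₑ sⱼ sₓ b c eq sⱼ²≡1 = begin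
    (- sₑ) * (sⱼ * b)         ≡⟨ solve (sₑ ∷ sⱼ ∷ b ∷ []) ⟩
    - (sⱼ * (sₑ * b))         ≡⟨ cong (λ t → - (sⱼ * t)) eq ⟩
    - (sⱼ * (sₓ * sⱼ * c))    ≡⟨ solve (sⱼ ∷ sₓ ∷ c ∷ []) ⟩
    - (sₓ * (sⱼ * sⱼ * c))    ≡⟨ cong (λ t → - (sₓ * (t * c))) sⱼ²≡1 ⟩
    - (sₓ * (+ 1 * c))        ≡⟨ solve (sₓ ∷ c ∷ []) ⟩
    (- sₓ) * c                ∎
    where open ≡-Reasoning

Σj-bottom-diagonal : ∀ a i x J → a ℕ.< J →
  sgn (suc (a ℕ.+ i)) * Σj a i (- + suc (a ℕ.+ i)) (+ suc x - + suc (a ℕ.+ i)) J ≡ sgn (suc x) * (C x a * C x i)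
Σj-bottom-diagonal a i x J a<J = begin
  sgn (suc e) * Σj a i -[1+ e ] (+ suc x - + suc e) J
    ≡⟨ sym (sum-*ˡ 0 J (sgn (suc e)) _) ⟩
  sumFrom 0 J (λ j → sgn (suc e) * (sgn j * (C a j * (C i j * bin -[1+ e ] (+ suc x - + suc e + + j)))))
    ≡⟨ sum-cong 0 J termwise ⟩
  sumFrom 0 J (λ j → sgn (suc x) * (C a j * (C i j * C (x ℕ.+ j) e)))
    ≡⟨ sum-*ˡ 0 J (sgn (suc x)) _ ⟩
  sgn (suc x) * S a i e x J
    ≡⟨ cong (sgn (suc x) *_) (S-diagonal x a i J a<J) ⟩
  sgn (suc x) * (C x a * C x i) ∎
  where
  open ≡-Reasoning
  e = a ℕ.+ i
  shift : ∀ x e j → + 1 + x - (+ 1 + e) + j ≡ x + j - e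
  shift = solve-∀
  regroup : ∀ s s′ α β b → s * (s′ * (α * (β * b))) ≡ α * (β * (s * (s′ * b)))
  regroup = solve-∀
  pull-out : ∀ s α β c → α * (β * (s * c)) ≡ s * (α * (β * c))
  pull-out = solve-∀
  termwise : ∀ j → sgn (suc e) * (sgn j * (C a j * (C i j * bin -[1+ e ] (+ suc x - + suc e + + j))))
                 ≡ sgn (suc x) * (C a j * (C i j * C (x ℕ.+ j) e))
  termwise j = begin
    sgn (suc e) * (sgn j * (C a j * (C i j * bin -[1+ e ] (+ suc x - + suc e + + j))))
      ≡⟨ cong (λ q → sgn (suc e) * (sgn j * (C a j * (C i j * bin -[1+ e ] q))))
              (trans (shift (+ x) (+ e) (+ j)) (ℤP.[+m]-[+n]≡m⊖n (x ℕ.+ j) e)) ⟩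
    sgn (suc e) * (sgn j * (C a j * (C i j * bin -[1+ e ] ((x ℕ.+ j) ⊖ e))))
      ≡⟨ regroup (sgn (suc e)) (sgn j) (C a j) (C i j) _ ⟩
    C a j * (C i j * (sgn (suc e) * (sgn j * bin -[1+ e ] ((x ℕ.+ j) ⊖ e))))
      ≡⟨ cong (λ t → C a j * (C i j * t)) (upper-negation-signed e x j) ⟩
    C a j * (C i j * (sgn (suc x) * C (x ℕ.+ j) e))
      ≡⟨ pull-out (sgn (suc x)) (C a j) (C i j) (C (x ℕ.+ j) e) ⟩
    sgn (suc x) * (C a j * (C i j * C (x ℕ.+ j) e)) ∎

Σv≡Σj-bottom : ∀ a i z U J → z ≤ + U → a ℕ.< J →
  Σv a i 0 (- z) U ≡ sgn (suc (a ℕ.+ i)) * Σj a i (- + suc (a ℕ.+ i)) (z - + suc (a ℕ.+ i)) J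
Σv≡Σj-bottom a i (+ zero)   U J _          _   = begin
  Σv a i 0 (+ 0) U                                     ≡⟨ Σv-bottom-nonneg a i 0 U ⟩
  + 0                                                 ≡⟨ sym (ℤP.*-zeroʳ (sgn (suc (a ℕ.+ i)))) ⟩
  sgn (suc (a ℕ.+ i)) * + 0                           ≡⟨ cong (sgn (suc (a ℕ.+ i)) *_) (sym (Σj-below a i -[1+ a ℕ.+ i ] (a ℕ.+ i) J (ℕP.m≤m+n a i))) ⟩
  sgn (suc (a ℕ.+ i)) * Σj a i -[1+ a ℕ.+ i ] -[1+ a ℕ.+ i ] J ∎
  where open ≡-Reasoning
Σv≡Σj-bottom a i -[1+ t ]   U J _          _   = begin
  Σv a i 0 (+ suc t) U                                 ≡⟨ Σv-bottom-nonneg a i (suc t) U ⟩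
  + 0                                                 ≡⟨ sym (ℤP.*-zeroʳ (sgn (suc (a ℕ.+ i)))) ⟩
  sgn (suc (a ℕ.+ i)) * + 0                           ≡⟨ cong (sgn (suc (a ℕ.+ i)) *_) (sym (Σj-below a i -[1+ a ℕ.+ i ] (suc (t ℕ.+ (a ℕ.+ i))) J a≤t+a+i)) ⟩
  sgn (suc (a ℕ.+ i)) * Σj a i -[1+ a ℕ.+ i ] -[1+ suc (t ℕ.+ (a ℕ.+ i)) ] J ∎
  where
  open ≡-Reasoning
  a≤t+a+i : a ℕ.≤ suc (t ℕ.+ (a ℕ.+ i))
  a≤t+a+i = ℕP.≤-trans (ℕP.m≤m+n a i) (ℕP.≤-trans (ℕP.m≤n+m (a ℕ.+ i) t) (ℕP.n≤1+n _))
Σv≡Σj-bottom a i (+ suc x) U J (+≤+ x<U) a<J =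
  trans (Σv-bottom-single a i x U x<U) (sym (Σj-bottom-diagonal a i x J a<J))

[x+y]-1≡[x-1]+y : ∀ x y → x + y - + 1 ≡ x - + 1 + y
[x+y]-1≡[x-1]+y = solve-∀

Σv-pascal : ∀ a i N s U → Σv a i (suc N) s U ≡ Σv a i N (s - + 1) U + Σv a i N s U
Σv-pascal a i N s U = trans (sum-cong 0 U termwise) (sum-+ 0 U _ _)
  where
  distrib : ∀ σ α x y β → σ * (α * ((x + y) * β)) ≡ σ * (α * (x * β)) + σ * (α * (y * β))
  distrib = solve-∀
  termwise : ∀ v → sgn (suc v) * (C v a * (bin (+ suc N) (s + + suc v) * C v i))
                 ≡ sgn (suc v) * (C v a * (bin (+ N) (s - + 1 + + suc v) * C v i))
                   + sgn (suc v) * (C v a * (bin (+ N) (s + + suc v) * C v i))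
  termwise v = trans
    (cong (λ b → sgn (suc v) * (C v a * (b * C v i)))
          (trans (bin-pascal (+ N) (s + + suc v))
                 (cong (λ t → bin (+ N) t + bin (+ N) (s + + suc v)) ([x+y]-1≡[x-1]+y s (+ suc v)))))
    (distrib (sgn (suc v)) (C v a) (bin (+ N) (s - + 1 + + suc v)) (bin (+ N) (s + + suc v)) (C v i))

Σj-pascal : ∀ a i n q J → Σj a i (+ 1 + n) q J ≡ Σj a i n (q - + 1) J + Σj a i n q J
Σj-pascal a i n q J = trans (sum-cong 0 J termwise) (sum-+ 0 J _ _)
  where
  distrib : ∀ σ α β x y → σ * (α * (β * (x + y))) ≡ σ * (α * (β * x)) + σ * (α * (β * y))
  distrib = solve-∀
  termwise : ∀ j → sgn j * (C a j * (C i j * bin (+ 1 + n) (q + + j)))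
                 ≡ sgn j * (C a j * (C i j * bin n (q - + 1 + + j))) + sgn j * (C a j * (C i j * bin n (q + + j)))
  termwise j = trans
    (cong (λ b → sgn j * (C a j * (C i j * b)))
          (trans (bin-pascal n (q + + j)) (cong (λ t → bin n t + bin n (q + + j)) ([x+y]-1≡[x-1]+y q (+ j)))))
    (distrib (sgn j) (C a j) (C i j) (bin n (q - + 1 + + j)) (bin n (q + + j)))

Σv≡Σj : ∀ a i N (n q : ℤ) U J → + N ≡ n + + suc (a ℕ.+ i) → q + + suc (a ℕ.+ i) ≤ + U → a ℕ.< J →
      Σv a i N (n - q) U ≡ sgn (suc (a ℕ.+ i)) * Σj a i n q J
Σv≡Σj a i zero    n q U J N≡n+c q+c≤U a<J = begin
  Σv a i 0 (n - q) U                  ≡⟨ cong (λ s → Σv a i 0 s U) n-q≡-[q+c] ⟩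
  Σv a i 0 (- (q + c)) U              ≡⟨ Σv≡Σj-bottom a i (q + c) U J q+c≤U a<J ⟩
  sgn (suc (a ℕ.+ i)) * Σj a i (- c) (q + c - c) J ≡⟨ cong₂ (λ n′ q′ → sgn (suc (a ℕ.+ i)) * Σj a i n′ q′ J) (sym n≡-c) (cancel q c) ⟩
  sgn (suc (a ℕ.+ i)) * Σj a i n q J ∎
  where
  open ≡-Reasoning
  c = + suc (a ℕ.+ i)
  cancel : ∀ x c → x + c - c ≡ x
  cancel = solve-∀
  n≡-c : n ≡ - c
  n≡-c = trans (sym (cancel n c)) (trans (cong (_- c) (sym N≡n+c)) (ℤP.+-identityˡ (- c)))
  negate-sum : ∀ c q → - c - q ≡ - (q + c)
  negate-sum = solve-∀
  n-q≡-[q+c] : n - q ≡ - (q + c)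
  n-q≡-[q+c] = trans (cong (_- q) n≡-c) (negate-sum c q)
Σv≡Σj a i (suc N) n q U J N≡n+c q+c≤U a<J = begin
  Σv a i (suc N) (n - q) U                            ≡⟨ Σv-pascal a i N (n - q) U ⟩
  Σv a i N (n - q - + 1) U + Σv a i N (n - q) U       ≡⟨ cong₂ (λ s s′ → Σv a i N s U + Σv a i N s′ U) (shift₁ n q) (shift₂ n q) ⟩
  Σv a i N (n′ - q) U + Σv a i N (n′ - (q - + 1)) U   ≡⟨ cong₂ _+_ (Σv≡Σj a i N n′ q U J N≡n′+c q+c≤U a<J)
                                                                   (Σv≡Σj a i N n′ (q - + 1) U J N≡n′+c q-1+c≤U a<J) ⟩
  σ * Σj a i n′ q J + σ * Σj a i n′ (q - + 1) J       ≡⟨ factor σ (Σj a i n′ q J) (Σj a i n′ (q - + 1) J) ⟩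
  σ * (Σj a i n′ (q - + 1) J + Σj a i n′ q J)         ≡⟨ cong (σ *_) (sym (Σj-pascal a i n′ q J)) ⟩
  σ * Σj a i (+ 1 + n′) q J                           ≡⟨ cong (λ n → σ * Σj a i n q J) (shift₃ n) ⟩
  σ * Σj a i n q J                                    ∎
  where
  open ≡-Reasoning
  c = + suc (a ℕ.+ i)
  σ = sgn (suc (a ℕ.+ i))
  n′ = n - + 1
  N≡n′+c : + N ≡ n′ + c
  N≡n′+c = trans (cong (_- + 1) N≡n+c) ([x+y]-1≡[x-1]+y n c)
  q-1+c≤U : q - + 1 + c ≤ + U
  q-1+c≤U = subst (_≤ + U) (trans (ℤP.+-comm (- + 1) (q + c)) ([x+y]-1≡[x-1]+y q c)) (ℤP.i≤j⇒pred[i]≤j q+c≤U)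
  shift₁ : ∀ n q → n - q - + 1 ≡ n - + 1 - q
  shift₁ = solve-∀
  shift₂ : ∀ n q → n - q ≡ n - + 1 - (q - + 1)
  shift₂ = solve-∀
  shift₃ : ∀ n → + 1 + (n - + 1) ≡ n
  shift₃ = solve-∀
  factor : ∀ s x y → s * x + s * y ≡ s * (y + x)
  factor = solve-∀

-- Binomial orthogonality

δ : ℕ → ℕ → ℤ
δ zero    zero    = + 1
δ zero    (suc _) = + 0
δ (suc _) zero    = + 0
δ (suc m) (suc n) = δ m n

δ-sym : ∀ m n → δ m n ≡ δ n m
δ-sym zero    zero    = refl
δ-sym zero    (suc n) = refl
δ-sym (suc m) zero    = refl
δ-sym (suc m) (suc n) = δ-sym m n

δ< : ℕ → ℕ → ℤ
δ< j       zero    = + 0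
δ< zero    (suc k) = + 1
δ< (suc j) (suc k) = δ< j k

δ<-suc : ∀ j k → δ< j (suc k) ≡ δ< j k + δ j k
δ<-suc zero    zero    = refl
δ<-suc zero    (suc k) = refl
δ<-suc (suc j) zero    = refl
δ<-suc (suc j) (suc k) = δ<-suc j k

δ<-< : ∀ {j k} → j ℕ.< k → δ< j k ≡ + 1
δ<-< {zero}  {suc k} _         = refl
δ<-< {suc j} {suc k} (s≤s j<k) = δ<-< j<k

δ<-≥ : ∀ {j k} → k ℕ.≤ j → δ< j k ≡ + 0
δ<-≥ {j}     {zero}  _         = refl
δ<-≥ {suc j} {suc k} (s≤s k≤j) = δ<-≥ k≤j

orthogonality : ∀ k j L → k ℕ.< L → sumFrom 0 L (λ a → sgn (a ℕ.+ j) * (C k a * C a j)) ≡ δ k j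

orthogonality-shifted : ∀ k j L → k ℕ.< L →
  sumFrom 0 L (λ a → sgn (suc a ℕ.+ j) * (C k a * C (suc a) j)) ≡ δ (suc k) j - δ k j
orthogonality-shifted k zero    L k<L = begin
  sumFrom 0 L (λ a → - sgn (a ℕ.+ 0) * (C k a * C a 0)) ≡⟨ sum-cong 0 L (λ a → sym (ℤP.neg-distribˡ-* (sgn (a ℕ.+ 0)) _)) ⟩
  sumFrom 0 L (λ a → - (sgn (a ℕ.+ 0) * (C k a * C a 0))) ≡⟨ sum-neg 0 L _ ⟩
  - sumFrom 0 L (λ a → sgn (a ℕ.+ 0) * (C k a * C a 0)) ≡⟨ cong -_ (orthogonality k 0 L k<L) ⟩
  - δ k 0                                                 ≡⟨ sym (ℤP.+-identityˡ (- δ k 0)) ⟩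
  + 0 - δ k 0                                             ∎
  where open ≡-Reasoning
orthogonality-shifted k (suc j) L k<L = begin
  sumFrom 0 L (λ a → sgn (suc a ℕ.+ suc j) * (C k a * C (suc a) (suc j)))
    ≡⟨ sum-cong 0 L pascal ⟩
  sumFrom 0 L (λ a → sgn (a ℕ.+ j) * (C k a * C a j) - sgn (a ℕ.+ suc j) * (C k a * C a (suc j)))
    ≡⟨ sum-- 0 L _ _ ⟩
  sumFrom 0 L (λ a → sgn (a ℕ.+ j) * (C k a * C a j)) - sumFrom 0 L (λ a → sgn (a ℕ.+ suc j) * (C k a * C a (suc j)))
    ≡⟨ cong₂ _-_ (orthogonality k j L k<L) (orthogonality k (suc j) L k<L) ⟩
  δ k j - δ k (suc j) ∎
  where
  open ≡-Reasoning
  split : ∀ s α x y → (- (- s)) * (α * (x + y)) ≡ s * (α * x) - (- s) * (α * y)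
  split = solve-∀
  pascal : ∀ a → sgn (suc a ℕ.+ suc j) * (C k a * C (suc a) (suc j))
               ≡ sgn (a ℕ.+ j) * (C k a * C a j) - sgn (a ℕ.+ suc j) * (C k a * C a (suc j))
  pascal a rewrite ℕP.+-suc a j = split (sgn (a ℕ.+ j)) (C k a) (C a j) (C a (suc j))

orthogonality zero    j (suc L) 0<L = begin
  sumFrom 0 (suc L) (λ a → sgn (a ℕ.+ j) * (C 0 a * C a j))
    ≡⟨ sum-single 0 (suc L) (λ a → sgn (a ℕ.+ j) * (C 0 a * C a j)) 0 z≤n 0<L (λ { zero a≢0 → ⊥-elim (a≢0 refl) ; (suc a) _ → ℤP.*-zeroʳ (sgn (suc a ℕ.+ j)) }) ⟩
  sgn j * (+ 1 * C 0 j) ≡⟨ cong (sgn j *_) (ℤP.*-identityˡ (C 0 j)) ⟩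
  sgn j * C 0 j         ≡⟨ at-0 j ⟩
  δ 0 j                 ∎
  where
  open ≡-Reasoning
  at-0 : ∀ j → sgn j * C 0 j ≡ δ 0 j
  at-0 zero    = refl
  at-0 (suc j) = ℤP.*-zeroʳ (sgn (suc j))
orthogonality (suc k) j (suc L) (s≤s k<L) = begin
  sumFrom 0 (suc L) (λ a → sgn (a ℕ.+ j) * (C (suc k) a * C a j))
    ≡⟨ trans (sum-cong 0 (suc L) pascal) (sum-+ 0 (suc L) (λ a → sgn (a ℕ.+ j) * (C k a * C a j)) (λ a → sgn (a ℕ.+ j) * (C-below a * C a j))) ⟩
  sumFrom 0 (suc L) (λ a → sgn (a ℕ.+ j) * (C k a * C a j)) + sumFrom 0 (suc L) (λ a → sgn (a ℕ.+ j) * (C-below a * C a j))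
    ≡⟨ cong (λ t → sumFrom 0 (suc L) (λ a → sgn (a ℕ.+ j) * (C k a * C a j)) + t)
            (trans (cong (_+ sumFrom 1 L (λ a → sgn (a ℕ.+ j) * (C-below a * C a j))) (ℤP.*-zeroʳ (sgn j)))
            (trans (ℤP.+-identityˡ _) (sum-shift 0 L (λ a → sgn (a ℕ.+ j) * (C-below a * C a j))))) ⟩
  sumFrom 0 (suc L) (λ a → sgn (a ℕ.+ j) * (C k a * C a j)) + sumFrom 0 L (λ a → sgn (suc a ℕ.+ j) * (C k a * C (suc a) j))
    ≡⟨ cong₂ _+_ (orthogonality k j (suc L) (ℕP.m<n⇒m<1+n k<L)) (orthogonality-shifted k j L k<L) ⟩
  δ k j + (δ (suc k) j - δ k j) ≡⟨ cancel (δ k j) (δ (suc k) j) ⟩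
  δ (suc k) j ∎
  where
  open ≡-Reasoning
  cancel : ∀ x y → x + (y - x) ≡ y
  cancel = solve-∀
  C-below : ℕ → ℤ
  C-below zero    = + 0
  C-below (suc a) = C k a
  distrib : ∀ s x y z → s * ((x + y) * z) ≡ s * (x * z) + s * (y * z)
  distrib = solve-∀
  pascal : ∀ a → sgn (a ℕ.+ j) * (C (suc k) a * C a j) ≡ sgn (a ℕ.+ j) * (C k a * C a j) + sgn (a ℕ.+ j) * (C-below a * C a j)
  pascal zero    = distrib (sgn j) (+ 1) (+ 0) (C 0 j)
  pascal (suc a) = trans (cong (λ t → sgn (suc a ℕ.+ j) * (t * C (suc a) j))
                                (trans (ℤP.pos-+ (choose k a) (choose k (suc a))) (ℤP.+-comm (C k a) (C k (suc a)))))
                         (distrib (sgn (suc a ℕ.+ j)) (C k (suc a)) (C k a) (C (suc a) j))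

orthogonality-< : ∀ k j L → k ℕ.≤ L → sumFrom 0 L (λ a → sgn (a ℕ.+ j) * (C k (suc a) * C a j)) ≡ δ< j k
orthogonality-< zero    j L _       = sum-zero 0 L (λ a _ _ → ℤP.*-zeroʳ (sgn (a ℕ.+ j)))
orthogonality-< (suc k) j L 1+k≤L = begin
  sumFrom 0 L (λ a → sgn (a ℕ.+ j) * ((C k a + C k (suc a)) * C a j))
    ≡⟨ trans (sum-cong 0 L (λ a → distrib (sgn (a ℕ.+ j)) (C k a) (C k (suc a)) (C a j)))
             (sum-+ 0 L (λ a → sgn (a ℕ.+ j) * (C k a * C a j)) (λ a → sgn (a ℕ.+ j) * (C k (suc a) * C a j))) ⟩
  sumFrom 0 L (λ a → sgn (a ℕ.+ j) * (C k a * C a j)) + sumFrom 0 L (λ a → sgn (a ℕ.+ j) * (C k (suc a) * C a j))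
    ≡⟨ cong₂ _+_ (orthogonality k j L 1+k≤L) (orthogonality-< k j L (ℕP.<⇒≤ 1+k≤L)) ⟩
  δ k j + δ< j k ≡⟨ trans (ℤP.+-comm (δ k j) (δ< j k)) (cong (λ t → δ< j k + t) (δ-sym k j)) ⟩
  δ< j k + δ j k ≡⟨ sym (δ<-suc j k) ⟩
  δ< j (suc k)   ∎
  where
  open ≡-Reasoning
  distrib : ∀ s x y z → s * ((x + y) * z) ≡ s * (x * z) + s * (y * z)
  distrib = solve-∀

sum-δ< : ∀ k L (f : ℕ → ℤ) → k ℕ.≤ L → sumFrom 0 L (λ j → δ< j k * f j) ≡ sumFrom 0 k f
sum-δ< k L f k≤L with ℕP.m≤n⇒∃[o]m+o≡n k≤L
... | d , refl = begin
  sumFrom 0 (k ℕ.+ d) (λ j → δ< j k * f j)                       ≡⟨ sum-split 0 k d _ ⟩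
  sumFrom 0 k (λ j → δ< j k * f j) + sumFrom k d (λ j → δ< j k * f j) ≡⟨ cong₂ _+_ (sum-cong-< 0 k below) (sum-zero k d above) ⟩
  sumFrom 0 k f + + 0                                            ≡⟨ ℤP.+-identityʳ _ ⟩
  sumFrom 0 k f                                                  ∎
  where
  open ≡-Reasoning
  below : ∀ j → 0 ℕ.≤ j → j ℕ.< k → δ< j k * f j ≡ f j
  below j _ j<k = trans (cong (_* f j) (δ<-< j<k)) (ℤP.*-identityˡ (f j))
  above : ∀ j → k ℕ.≤ j → j ℕ.< k ℕ.+ d → δ< j k * f j ≡ + 0
  above j k≤j _ = cong (_* f j) (δ<-≥ k≤j)

Σj-inversion : ∀ k i L (n q : ℤ) → k ℕ.≤ L →
  sumFrom 0 L (λ a → C k (suc a) * (sgn (suc (a ℕ.+ i)) * Σj a i n q L))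
    ≡ sgn (suc i) * sumFrom 0 k (λ j → C i j * bin n (q + + j))
Σj-inversion k i L n q k≤L = begin
  sumFrom 0 L (λ a → C k (suc a) * (sgn (suc (a ℕ.+ i)) * Σj a i n q L))
    ≡⟨ sum-cong 0 L (λ a → trans (cong (C k (suc a) *_) (sym (sum-*ˡ 0 L (sgn (suc (a ℕ.+ i))) _)))
                                 (sym (sum-*ˡ 0 L (C k (suc a)) _))) ⟩
  sumFrom 0 L (λ a → sumFrom 0 L (λ j → C k (suc a) * (sgn (suc (a ℕ.+ i)) * (sgn j * (C a j * Y j)))))
    ≡⟨ sum-cong 0 L (λ a → sum-cong 0 L (regroup a)) ⟩
  sumFrom 0 L (λ a → sumFrom 0 L (λ j → sgn (suc i) * (sgn (a ℕ.+ j) * (C k (suc a) * C a j) * Y j)))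
    ≡⟨ sum-comm 0 L 0 L _ ⟩
  sumFrom 0 L (λ j → sumFrom 0 L (λ a → sgn (suc i) * (sgn (a ℕ.+ j) * (C k (suc a) * C a j) * Y j)))
    ≡⟨ sum-cong 0 L (λ j → trans (sum-*ˡ 0 L (sgn (suc i)) _) (cong (sgn (suc i) *_)
         (trans (sum-*ʳ 0 L (λ a → sgn (a ℕ.+ j) * (C k (suc a) * C a j)) (Y j))
                (cong (_* Y j) (orthogonality-< k j L k≤L))))) ⟩
  sumFrom 0 L (λ j → sgn (suc i) * (δ< j k * Y j))
    ≡⟨ sum-*ˡ 0 L (sgn (suc i)) _ ⟩
  sgn (suc i) * sumFrom 0 L (λ j → δ< j k * Y j)
    ≡⟨ cong (sgn (suc i) *_) (sum-δ< k L Y k≤L) ⟩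
  sgn (suc i) * sumFrom 0 k Y ∎
  where
  open ≡-Reasoning
  Y : ℕ → ℤ
  Y j = C i j * bin n (q + + j)
  signs : ∀ κ sₐ sᵢ sⱼ α y → κ * ((- (sₐ * sᵢ)) * (sⱼ * (α * y))) ≡ (- sᵢ) * (sₐ * sⱼ * (κ * α) * y)
  signs = solve-∀
  regroup : ∀ a j → C k (suc a) * (sgn (suc (a ℕ.+ i)) * (sgn j * (C a j * Y j)))
                  ≡ sgn (suc i) * (sgn (a ℕ.+ j) * (C k (suc a) * C a j) * Y j)
  regroup a j rewrite sgn-+ a i | sgn-+ a j = signs (C k (suc a)) (sgn a) (sgn i) (sgn j) (C a j) (Y j)

summand : ℤ → ℕ → ℕ → ℕ → ℕ → ℕ → ℤ
summand p m k i l u = sgn u * binom (+ k) (+ l) * binom (+ u - + 1) (+ l - + 1)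
                        * binom (+ m + + l) (+ m - p + + u) * binom (+ u - + 1) (+ i)

summand-as-Σv : ∀ p m k i L U →
  sumFrom 1 L (λ l → sumFrom 1 U (summand p m k i l)) ≡ sumFrom 0 L (λ a → C k (suc a) * Σv a i (m ℕ.+ suc a) (+ m - p) U)
summand-as-Σv p m k i L U = trans (sum-shift 0 L _) (sum-cong 0 L (λ a →
  trans (sum-shift 0 U _) (trans (sum-cong 0 U (termwise a)) (sum-*ˡ 0 U (C k (suc a)) _))))
  where
  regroup : ∀ s κ α β γ → s * κ * α * β * γ ≡ κ * (s * (α * (β * γ)))
  regroup = solve-∀
  termwise : ∀ a v → summand p m k i (suc a) (suc v)
                   ≡ C k (suc a) * (sgn (suc v) * (C v a * (bin (+ (m ℕ.+ suc a)) (+ m - p + + suc v) * C v i)))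
  termwise a v rewrite binom≡bin (+ k) (+ suc a) | binom≡bin (+ v) (+ a)
                     | binom≡bin (+ (m ℕ.+ suc a)) (+ m - p + + suc v) | binom≡bin (+ v) (+ i) =
    regroup (sgn (suc v)) (C k (suc a)) (C v a) (bin (+ (m ℕ.+ suc a)) (+ m - p + + suc v)) (C v i)

Σv-as-Σj : ∀ p m k i L U → p + + k ≤ + U →
  sumFrom 0 L (λ a → C k (suc a) * Σv a i (m ℕ.+ suc a) (+ m - p) U)
    ≡ sumFrom 0 L (λ a → C k (suc a) * (sgn (suc (a ℕ.+ i)) * Σj a i (+ m - + i) (p - + i) L))
Σv-as-Σj p m k i L U p+k≤U = sum-cong-< 0 L termwise
  where
  m-p : ∀ m p i → m - p ≡ (m - i) - (p - i)
  m-p = solve-∀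
  N≡n+c : ∀ m a i → m + (+ 1 + a) ≡ (m - i) + (+ 1 + (a + i))
  N≡n+c = solve-∀
  q+c : ∀ p a i → (p - i) + (+ 1 + (a + i)) ≡ p + (+ 1 + a)
  q+c = solve-∀
  termwise : ∀ a → 0 ℕ.≤ a → a ℕ.< L →
    C k (suc a) * Σv a i (m ℕ.+ suc a) (+ m - p) U ≡ C k (suc a) * (sgn (suc (a ℕ.+ i)) * Σj a i (+ m - + i) (p - + i) L)
  termwise a _ a<L with suc a ℕ.≤? k
  ... | yes a<k = cong (C k (suc a) *_) (trans (cong (λ s → Σv a i (m ℕ.+ suc a) s U) (m-p (+ m) p (+ i)))
        (Σv≡Σj a i (m ℕ.+ suc a) (+ m - + i) (p - + i) U L (N≡n+c (+ m) (+ a) (+ i))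
             (subst (_≤ + U) (sym (q+c p (+ a) (+ i))) (ℤP.≤-trans (ℤP.+-monoʳ-≤ p (+≤+ a<k)) p+k≤U)) a<L))
  ... | no a≮k = trans (cong (_* Σv a i (m ℕ.+ suc a) (+ m - p) U) (C-< (ℕP.≰⇒> a≮k)))
                       (sym (cong (_* (sgn (suc (a ℕ.+ i)) * Σj a i (+ m - + i) (p - + i) L)) (C-< (ℕP.≰⇒> a≮k))))

lemmaA1 : (p : ℤ) (m k i L U : ℕ) → k ≤ℕ L → p + + k ≤ + U →
    sumFrom 1 L (λ l → sumFrom 1 U (λ u →
        sgn u * binom (+ k) (+ l) * binom (+ u - + 1) (+ l - + 1)
          * binom (+ m + + l) (+ m - p + + u) * binom (+ u - + 1) (+ i)))
      ≡ sgn (suc i) * sumFrom 0 k (λ l → binom (+ i) (+ l) * binom (+ m - + i) (p - + i + + l))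
lemmaA1 p m k i L U k≤L p+k≤U = begin
  sumFrom 1 L (λ l → sumFrom 1 U (summand p m k i l))
    ≡⟨ summand-as-Σv p m k i L U ⟩
  sumFrom 0 L (λ a → C k (suc a) * Σv a i (m ℕ.+ suc a) (+ m - p) U)
    ≡⟨ Σv-as-Σj p m k i L U p+k≤U ⟩
  sumFrom 0 L (λ a → C k (suc a) * (sgn (suc (a ℕ.+ i)) * Σj a i (+ m - + i) (p - + i) L))
    ≡⟨ Σj-inversion k i L (+ m - + i) (p - + i) k≤L ⟩
  sgn (suc i) * sumFrom 0 k (λ l → C i l * bin (+ m - + i) (p - + i + + l))
    ≡⟨ cong (sgn (suc i) *_) (sum-cong 0 k (λ l → sym (cong₂ _*_ (binom≡bin (+ i) (+ l)) (binom≡bin (+ m - + i) (p - + i + + l))))) ⟩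
  sgn (suc i) * sumFrom 0 k (λ l → binom (+ i) (+ l) * binom (+ m - + i) (p - + i + + l)) ∎
  where open ≡-Reasoning
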